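{- Let $H$ and $K$ be subgroups of a finite group $G$ such that $HK$ is a subgroup of $G$. If $H\cap K$ is a perfect code of $K$, then $H$ is a perfect code of $HK$.
   Context: A perfect code in a simple undirected graph with vertex set $V$ is an independent subset $C\subseteq V$ such that every vertex in $V\setminus C$ is adjacent to exactly one vertex of $C$. For a group $G$ with identity $e$ and an inverse-closed $S\subseteq G\setminus\{e\}$, the Cayley graph $\mathrm{Cay}(G,S)$ has vertex set $G$ and edges $\{g,sg\}$ ($s\in S$, $g\in G$). A subset $C$ of $G$ is a perfect code of $G$ if it is a perfect code in some Cayley graph $\mathrm{Cay}(G,S)$. -}

module Defs where

open import Level using (Level; _⊔_; suc)
open import Algebra.Bundles using (Group)
open import Data.Product using (Σ; ∃; _×_; _,_)
open import Data.List using (List)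
open import Data.List.Relation.Unary.Any using (Any)
open import Relation.Nullary using (¬_)
open import Relation.Unary using (Pred)

module _ {c ℓ : Level} (G : Group c ℓ) where
  open Group G

  Subset : Set (suc (c ⊔ ℓ))
  Subset = Pred Carrier (c ⊔ ℓ)

  Respects≈ : Subset → Set (c ⊔ ℓ)
  Respects≈ P = ∀ {x y} → x ≈ y → P x → P y

  IsFinite : Set (c ⊔ ℓ)
  IsFinite = Σ (List Carrier) λ xs → ∀ x → Any (x ≈_) xs

  record IsSubgroup (P : Subset) : Set (c ⊔ ℓ) where
    field
      resp  : Respects≈ P
      ε∈    : P ε
      ∙-closed : ∀ {x y} → P x → P y → P (x ∙ y)
      ⁻¹-closed : ∀ {x} → P x → P (x ⁻¹)

  _∩_ : Subset → Subset → Subset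
  (P ∩ Q) x = P x × Q x

  _·_ : Subset → Subset → Subset
  (P · Q) x = ∃ λ p → ∃ λ q → P p × Q q × (x ≈ p ∙ q)

  Adj : Subset → Carrier → Carrier → Set (c ⊔ ℓ)
  Adj S x y = ∃ λ s → S s × (y ≈ s ∙ x)

  record IsPerfectCodeIn (L S C : Subset) : Set (c ⊔ ℓ) where
    field
      independent : ∀ {c c'} → C c → C c' → ¬ Adj S c c'
      covers      : ∀ {v} → L v → ¬ C v → ∃ λ c → C c × Adj S v c
      unique      : ∀ {v c c'} → L v → ¬ C v → C c → C c' →
                    Adj S v c → Adj S v c' → c ≈ c'

  -- C is a perfect code of the (sub)group L: C ⊆ L and C is a perfect
  -- code in some Cayley graph Cay(L,S), S ⊆ L ∖ {e} inverse-closed.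
  record IsPerfectCodeOf (L C : Subset) : Set (suc (c ⊔ ℓ)) where
    field
      C-resp : Respects≈ C
      C⊆L    : ∀ {x} → C x → L x
      S      : Subset
      S-resp : Respects≈ S
      S⊆L    : ∀ {x} → S x → L x
      e∉S    : ∀ {x} → S x → ¬ (x ≈ ε)
      S⁻¹    : ∀ {x} → S x → S (x ⁻¹)
      perfect : IsPerfectCodeIn L S C

-- Keep the connection set S ⊆ K of the perfect code H ∩ K of K. Every v ∈ HK
-- factors as v = k h with k ∈ K, h ∈ H, and right multiplication by h is an
-- automorphism of Cay(G,S) sending k to v. Since S ⊆ K, the neighbours of k
-- stay in K, so this automorphism matches the neighbours of k lying in H ∩ K
-- with the neighbours of v lying in H; covering and uniqueness transfer along
-- it. Independence of H follows by translating an edge inside H to one at ε.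
module Submission where

open import Defs
open import Level using (Level)
open import Algebra.Bundles using (Group)
open import Data.Product using (∃; _×_; _,_)
open import Relation.Nullary using (¬_)
import Algebra.Properties.Group as GroupProperties
import Relation.Binary.Reasoning.Setoid as SetoidReasoning

module _ {c ℓ : Level} (G : Group c ℓ) where
  open Group G
  open GroupProperties G using (//-rightDividesˡ; //-rightDividesʳ; ⁻¹-involutive; ⁻¹-anti-homo-∙)
  open SetoidReasoning setoid

  module _ {S : Subset G} where

    Adj-respˡ : ∀ {x x′ y} → x ≈ x′ → Adj G S x y → Adj G S x′ y
    Adj-respˡ x≈x′ (s , s∈S , y≈sx) = s , s∈S , trans y≈sx (∙-congˡ x≈x′)

    Adj-∙ʳ : ∀ {x y} g → Adj G S x y → Adj G S (x ∙ g) (y ∙ g)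
    Adj-∙ʳ {x} {y} g (s , s∈S , y≈sx) = s , s∈S , (begin
      y ∙ g        ≈⟨ ∙-congʳ y≈sx ⟩
      s ∙ x ∙ g    ≈⟨ assoc s x g ⟩
      s ∙ (x ∙ g)  ∎)

    Adj-∙ʳ-//ʳ : ∀ {x y} g → Adj G S (x ∙ g) y → Adj G S x (y // g)
    Adj-∙ʳ-//ʳ {x} g adj = Adj-respˡ (//-rightDividesʳ g x) (Adj-∙ʳ (g ⁻¹) adj)

    Adj-preserves : ∀ {K} → IsSubgroup G K → (∀ {s} → S s → K s) →
                    ∀ {x y} → Adj G S x y → K x → K y
    Adj-preserves K-subgroup S⊆K (s , s∈S , y≈sx) x∈K =
      resp (sym y≈sx) (∙-closed (S⊆K s∈S) x∈K)
      where open IsSubgroup K-subgroup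

  module _ {H : Subset G} (H-subgroup : IsSubgroup G H) where
    open IsSubgroup H-subgroup

    //-closed : ∀ {x y} → H x → H y → H (x // y)
    //-closed x∈H y∈H = ∙-closed x∈H (⁻¹-closed y∈H)

  module _ {H K : Subset G} (H-subgroup : IsSubgroup G H) (K-subgroup : IsSubgroup G K) where
    private
      module H = IsSubgroup H-subgroup
      module K = IsSubgroup K-subgroup

    ⊆-·ʳ : ∀ {x} → H x → _·_ G H K x
    ⊆-·ʳ {x} x∈H = x , ε , x∈H , K.ε∈ , sym (identityʳ x)

    ⊆-·ˡ : ∀ {x} → K x → _·_ G H K x
    ⊆-·ˡ {x} x∈K = ε , x , H.ε∈ , x∈K , sym (identityˡ x)

    ·-swap : (∀ {x} → _·_ G H K x → _·_ G H K (x ⁻¹)) →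
             ∀ {v} → _·_ G H K v → _·_ G K H v
    ·-swap HK-⁻¹-closed {v} v∈HK with HK-⁻¹-closed v∈HK
    ... | h , k , h∈H , k∈K , v⁻¹≈hk =
      k ⁻¹ , h ⁻¹ , K.⁻¹-closed k∈K , H.⁻¹-closed h∈H , (begin
        v              ≈⟨ ⁻¹-involutive v ⟨
        v ⁻¹ ⁻¹        ≈⟨ ⁻¹-cong v⁻¹≈hk ⟩
        (h ∙ k) ⁻¹     ≈⟨ ⁻¹-anti-homo-∙ h k ⟩
        k ⁻¹ ∙ h ⁻¹    ∎)

  module _ {H K : Subset G} (H-subgroup : IsSubgroup G H) (K-subgroup : IsSubgroup G K)
           (HK-subgroup : IsSubgroup G (_·_ G H K))
           (code : IsPerfectCodeOf G K (_∩_ G H K)) where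
    private
      module H = IsSubgroup H-subgroup
      module K = IsSubgroup K-subgroup
      module HK = IsSubgroup HK-subgroup
      open IsPerfectCodeOf code using (S; S-resp; S⊆L; e∉S; S⁻¹; perfect)
      module C = IsPerfectCodeIn perfect

    H-neighbour⇒H∩K-neighbour : ∀ {k h x} → K k → H h → H x → Adj G S (k ∙ h) x →
                                _∩_ G H K (x // h) × Adj G S k (x // h)
    H-neighbour⇒H∩K-neighbour {k} {h} {x} k∈K h∈H x∈H adj =
      (//-closed H-subgroup x∈H h∈H , Adj-preserves K-subgroup S⊆L adj′ k∈K) , adj′
      where
      adj′ : Adj G S k (x // h)
      adj′ = Adj-∙ʳ-//ʳ h adj

    H-independent : ∀ {a b} → H a → H b → ¬ Adj G S a b
    H-independent {a} {b} a∈H b∈H adj = C.independent (H.ε∈ , K.ε∈) (b/a∈H , b/a∈K) adj′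
      where
      adj′ : Adj G S ε (b // a)
      adj′ = Adj-respˡ (inverseʳ a) (Adj-∙ʳ (a ⁻¹) adj)
      b/a∈H : H (b // a)
      b/a∈H = //-closed H-subgroup b∈H a∈H
      b/a∈K : K (b // a)
      b/a∈K = Adj-preserves K-subgroup S⊆L adj′ K.ε∈

    ∉H⇒∉H∩K : ∀ {v k h} → v ≈ k ∙ h → H h → ¬ H v → ¬ _∩_ G H K k
    ∉H⇒∉H∩K v≈kh h∈H v∉H (k∈H , _) = v∉H (H.resp (sym v≈kh) (H.∙-closed k∈H h∈H))

    H-covers : ∀ {v} → _·_ G H K v → ¬ H v → ∃ λ c → H c × Adj G S v c
    H-covers v∈HK v∉H with ·-swap H-subgroup K-subgroup HK.⁻¹-closed v∈HK
    ... | k , h , k∈K , h∈H , v≈kh with C.covers k∈K (∉H⇒∉H∩K v≈kh h∈H v∉H)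
    ... | d , (d∈H , _) , adj =
      d ∙ h , H.∙-closed d∈H h∈H , Adj-respˡ (sym v≈kh) (Adj-∙ʳ h adj)

    H-unique : ∀ {v a b} → _·_ G H K v → ¬ H v → H a → H b →
               Adj G S v a → Adj G S v b → a ≈ b
    H-unique {a = a} {b} v∈HK v∉H a∈H b∈H adj-a adj-b
      with ·-swap H-subgroup K-subgroup HK.⁻¹-closed v∈HK
    ... | k , h , k∈K , h∈H , v≈kh
      with H-neighbour⇒H∩K-neighbour k∈K h∈H a∈H (Adj-respˡ v≈kh adj-a)
         | H-neighbour⇒H∩K-neighbour k∈K h∈H b∈H (Adj-respˡ v≈kh adj-b)
    ... | a/h∈C , adj-a/h | b/h∈C , adj-b/h = begin
      a             ≈⟨ //-rightDividesˡ h a ⟨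
      (a // h) ∙ h  ≈⟨ ∙-congʳ a/h≈b/h ⟩
      (b // h) ∙ h  ≈⟨ //-rightDividesˡ h b ⟩
      b             ∎
      where
      a/h≈b/h : a // h ≈ b // h
      a/h≈b/h = C.unique k∈K (∉H⇒∉H∩K v≈kh h∈H v∉H) a/h∈C b/h∈C adj-a/h adj-b/h

    perfectCode-· : IsPerfectCodeOf G (_·_ G H K) H
    perfectCode-· = record
      { C-resp  = H.resp
      ; C⊆L     = ⊆-·ʳ H-subgroup K-subgroup
      ; S       = S
      ; S-resp  = S-resp
      ; S⊆L     = λ s∈S → ⊆-·ˡ H-subgroup K-subgroup (S⊆L s∈S)
      ; e∉S     = e∉S
      ; S⁻¹     = S⁻¹
      ; perfect = record
        { independent = H-independent
        ; covers      = H-covers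
        ; unique      = H-unique
        }
      }

lemma4p1 : {c ℓ : Level} (G : Group c ℓ) → IsFinite G →
           (H K : Subset G) → IsSubgroup G H → IsSubgroup G K →
           IsSubgroup G (_·_ G H K) →
           IsPerfectCodeOf G K (_∩_ G H K) →
           IsPerfectCodeOf G (_·_ G H K) H
lemma4p1 G _ H K = perfectCode-· G
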